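{- For all $n\geq 1$, whenever $\psi \in \mathcal L_{\Diamond}$ is such that $\varphi_n \equiv \psi$ on $\hat{\mathcal A}^n \cup \hat{\mathcal B}^n$, it follows that $|\psi| \geq 2^n$.
   Context: $\Diamond^{+}\theta:=\theta\vee\Diamond\theta$ (closure), $\varphi_1=\Diamond^{+}p_1$, $\varphi_{n+1}=\Diamond^{+}(p_{n+1}\wedge\varphi_n)$. $\mathcal L_{\Diamond}$ is the basic modal language in negation normal form; $|\psi|$ = number of nodes of its syntax tree; Kripke semantics. The finite irreflexive transitive tree models $\mathfrak A^n_i,\mathfrak B^n_i$ ($1\le i\le 2^n$) with roots $a^n_i,b^n_i$ and partial successor function $S$ ($S[\mathfrak M]$ = submodel generated by the successor of the root) are defined recursively: $\mathfrak A^1_1$ is one point satisfying only $p_1$, $\mathfrak B^1_1$ one point satisfying nothing; for $i\le 2^n$, $\mathfrak A^{n+1}_i$, $\mathfrak B^{n+1}_i$ are copies of $\mathfrak A^n_i$, $\mathfrak B^n_i$ with $p_{n+1}$ made true at the root; for $i=2^n+j$, $1\le j\le 2^n$, with $\mathfrak X=\coprod_{k=2}^{2^n}S[\mathfrak A^{n+1}_k]\amalg\mathfrak B^{n+1}_j$ and $\mathfrak Y=\mathfrak X\amalg\mathfrak A^{n+1}_j$, $\mathfrak B^{n+1}_{2^n+j}$ (resp. $\mathfrak A^{n+1}_{2^n+j}$) adds a fresh irreflexive atomless root seeing all of $\mathfrak X$ (resp. $\mathfrak Y$), whose successor is the root of $\mathfrak B^{n+1}_j$ (resp. $\mathfrak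 A^{n+1}_j$). For a Kripke model $\mathfrak K$, $\hat{\mathfrak K}$ adds a new point $\infty$ satisfying no atoms, with every point (including $\infty$ itself) seeing $\infty$; $\hat{\mathfrak K}$ is then a $\mathsf{TC}$ model. $\hat{\mathcal A}^n=\{(\hat{\mathfrak A}^n_i,a^n_i):1\le i\le 2^n\}$ and $\hat{\mathcal B}^n=\{(\hat{\mathfrak B}^n_i,b^n_i):1\le i\le 2^n\}$. -}

module Defs where

open import Data.Nat using (ℕ; zero; suc; _+_; _∸_; _^_; _≤ᵇ_)
open import Data.Bool using (if_then_else_)
open import Data.List using (List; []; _∷_; _++_; map; concatMap; upTo)
open import Data.List.Membership.Propositional using (_∈_)
open import Data.Maybe using (Maybe; just; nothing)
open import Data.Product using (_×_; _,_; proj₁; proj₂; Σ)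
open import Data.Sum using (_⊎_)
open import Data.Unit using (⊤)
open import Data.Empty using (⊥)
open import Relation.Nullary using (¬_)

-- Basic modal language in negation normal form.
-- Atom p_i is  var i  (p_1 = var 1, ...);  nvar i  is the literal ¬p_i.

data Fm : Set where
  var nvar : ℕ → Fm
  tt ff    : Fm
  _∧_ _∨_  : Fm → Fm → Fm
  ◇ □      : Fm → Fm

size : Fm → ℕ
size (var _)  = 1
size (nvar _) = 1
size tt       = 1
size ff       = 1
size (φ ∧ ψ)  = suc (size φ + size ψ)
size (φ ∨ ψ)  = suc (size φ + size ψ)
size (◇ φ)    = suc (size φ)
size (□ φ)    = suc (size φ)

◇⁺ : Fm → Fm
◇⁺ θ = θ ∨ ◇ θ

-- φ_1 = ◇⁺ p_1,  φ_{n+1} = ◇⁺ (p_{n+1} ∧ φ_n)   (φ 0 is an unused dummy)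
φ : ℕ → Fm
φ zero          = ◇⁺ (var 1)
φ (suc zero)    = ◇⁺ (var 1)
φ (suc (suc m)) = ◇⁺ (var (suc (suc m)) ∧ φ (suc m))

record Kripke : Set₁ where
  field
    W : Set
    R : W → W → Set
    V : ℕ → W → Set
open Kripke public

_∣_⊨_ : (K : Kripke) → W K → Fm → Set
K ∣ w ⊨ var i  = V K i w
K ∣ w ⊨ nvar i = ¬ V K i w
K ∣ w ⊨ tt     = ⊤
K ∣ w ⊨ ff     = ⊥
K ∣ w ⊨ (a ∧ b) = (K ∣ w ⊨ a) × (K ∣ w ⊨ b)
K ∣ w ⊨ (a ∨ b) = (K ∣ w ⊨ a) ⊎ (K ∣ w ⊨ b)
K ∣ w ⊨ ◇ a    = Σ (W K) λ v → R K w v × (K ∣ v ⊨ a)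
K ∣ w ⊨ □ a    = (v : W K) → R K w v → K ∣ v ⊨ a

-- K̂ : add a new point ∞ (= nothing), no atoms, seen by every point incl. itself
hat : Kripke → Kripke
hat K = record { W = Maybe (W K) ; R = Rh ; V = Vh }
  where
  Rh : Maybe (W K) → Maybe (W K) → Set
  Rh (just x) (just y) = R K x y
  Rh _        nothing  = ⊤
  Rh nothing  (just _) = ⊥
  Vh : ℕ → Maybe (W K) → Set
  Vh i (just x) = V K i x
  Vh i nothing  = ⊥

-- Finite irreflexive transitive tree models with a partial successor.
-- node atoms succ others : root satisfies exactly the atoms in 'atoms';
-- its immediate subtrees are 'succ' (if present; it is the successor of
-- the root) together with 'others'.

data Tree : Set where
  node : List ℕ → Maybe Tree → List Tree → Tree

children : Tree → List Tree
children (node _ nothing  cs) = cs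
children (node _ (just s) cs) = s ∷ cs

atomsOf : Tree → List ℕ
atomsOf (node as _ _) = as

-- points of the model = positions in the tree (disjoint: membership proofs
-- distinguish repeated copies)
data Pos : Tree → Set where
  here  : ∀ {t} → Pos t
  there : ∀ {t c} → c ∈ children t → Pos c → Pos t

label : ∀ {t} → Pos t → List ℕ
label {t} here  = atomsOf t
label (there _ p) = label p

-- accessibility = strict descendant (transitive, irreflexive)
data _≺_ : ∀ {t} → Pos t → Pos t → Set where
  root≺ : ∀ {t c} {m : c ∈ children t} {q : Pos c} → _≺_ {t} here (there m q)
  step≺ : ∀ {t c} {m : c ∈ children t} {p q : Pos c} → p ≺ q → _≺_ {t} (there m p) (there m q)

treeModel : Tree → Kripke
treeModel t = record { W = Pos t ; R = _≺_ ; V = λ i p → i ∈ label p }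

-- S[𝔐] : submodel generated by the successor of the root (as a list:
-- empty when the successor is undefined; it is defined wherever used)
S : Tree → List Tree
S (node _ (just s) _) = s ∷ []
S (node _ nothing  _) = []

addAtom : ℕ → Tree → Tree
addAtom a (node as s cs) = node (a ∷ as) s cs

-- one construction step: from the level-n family  prev k = (𝔄ⁿ_k , 𝔅ⁿ_k)
-- to (𝔄ⁿ⁺¹ᵢ , 𝔅ⁿ⁺¹ᵢ)
step : (n : ℕ) → (ℕ → Tree × Tree) → ℕ → Tree × Tree
step n prev i =
  if i ≤ᵇ N then (cA i , cB i)
  else ( node [] (just (cA j)) (Ss ++ (cB j ∷ []))
       , node [] (just (cB j)) Ss )
  where
  N : ℕ
  N = 2 ^ n
  cA cB : ℕ → Tree
  cA k = addAtom (suc n) (proj₁ (prev k))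
  cB k = addAtom (suc n) (proj₂ (prev k))
  j : ℕ
  j = i ∸ N
  -- ∐_{k=2}^{2ⁿ} S[𝔄ⁿ⁺¹_k]
  Ss : List Tree
  Ss = concatMap (λ k → S (cA k)) (map (2 +_) (upTo (N ∸ 1)))

-- AB n i = (𝔄ⁿᵢ , 𝔅ⁿᵢ) for n ≥ 1, 1 ≤ i ≤ 2ⁿ (other values are dummies)
AB : ℕ → ℕ → Tree × Tree
AB zero i          = node (1 ∷ []) nothing [] , node [] nothing []
AB (suc zero) i    =
  if i ≤ᵇ 1 then (𝔄¹₁ , 𝔅¹₁)
  -- i = 2 : the general step with n = 0, j = 1 (empty ∐ over k = 2..1):
  -- 𝔅¹₂ = root seeing 𝔅¹₁ (successor),  𝔄¹₂ = root seeing 𝔅¹₁ and 𝔄¹₁ (successor)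
  else (node [] (just 𝔄¹₁) (𝔅¹₁ ∷ []) , node [] (just 𝔅¹₁) [])
  where
  𝔄¹₁ 𝔅¹₁ : Tree
  𝔄¹₁ = node (1 ∷ []) nothing []
  𝔅¹₁ = node [] nothing []
AB (suc (suc m)) i = step (suc m) (AB (suc m)) i

𝔄 𝔅 : ℕ → ℕ → Tree
𝔄 n i = proj₁ (AB n i)
𝔅 n i = proj₂ (AB n i)

module Submission where

-- The proof is a formula-size game.  Say that χ separates a pair of trees
-- when it holds at the root of the first and fails at the root of the
-- second.  The module SizeGame shows abstractly: if a single node never
-- separates two distinct items, ∧ and ∨ separate only through one of their
-- arguments, □ separates nothing, and ◇ χ separating an item makes χ
-- separate a successor item via a move that keeps distinct items distinct,
-- then a formula separating k pairwise distinct items has at least k nodes.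
-- The rest of the file verifies these conditions for the pairs (𝔄ᵉᵢ, 𝔅ᵉᵢ):
-- truth is invariant under passing to a child (generated submodels); index
-- 1 is a pair of single points, and index 2ᵍ + j is a pair glued over
-- (𝔄ᵍ⁺¹_j, 𝔅ᵍ⁺¹_j) whose further children are shared; and φ_n separates
-- all 2ⁿ pairs of level n, hence so does ψ.  The game runs in the
-- double-negation monad (splitting a conjunction is classical); since the
-- conclusion 2ⁿ ≤ |ψ| is decidable this costs nothing.

open import Defs
open import Data.Nat using (ℕ; zero; suc; _+_; _∸_; _^_; _≤_; _<_; z≤n; s≤s; _≤ᵇ_)
open import Data.Nat.Properties
open import Data.Bool using (true; false; T)
open import Data.Bool.Properties using (T-≡)
open import Data.List using (List; []; _∷_; _++_; map; concatMap; upTo; applyUpTo; length)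
open import Data.List.Properties using (length-map; length-applyUpTo)
open import Data.List.Membership.Propositional using (_∈_; lose)
open import Data.List.Membership.Propositional.Properties using (∈-map⁺; ∈-++⁺ˡ; ∈-++⁺ʳ; ∈-++⁻; ∈-concatMap⁺; ∈-concatMap⁻; ∈-upTo⁺)
open import Data.List.Relation.Unary.Any using (here; there; satisfied)
open import Data.List.Relation.Unary.All using (All; []; _∷_)
import Data.List.Relation.Unary.All as All
import Data.List.Relation.Unary.All.Properties as All
open import Data.List.Relation.Unary.AllPairs using (AllPairs; []; _∷_)
import Data.List.Relation.Unary.AllPairs.Properties as AllPairs
open import Data.List.Relation.Binary.Sublist.Propositional using (_⊆_; []; _∷_; _∷ʳ_)
open import Data.List.Relation.Binary.Sublist.Propositional.Properties using (All-resp-⊆)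
open import Data.Maybe using (Maybe; just; nothing)
open import Data.Product using (_×_; _,_; proj₁; proj₂; Σ)
open import Data.Sum using (_⊎_; inj₁; inj₂)
open import Data.Unit using (⊤; tt)
open import Data.Empty using (⊥; ⊥-elim)
open import Effect.Monad using (RawMonad)
open import Function.Bundles using (_⇔_; mk⇔; Equivalence)
open import Level using (0ℓ)
open import Relation.Binary using (Tri; tri<; tri≈; tri>)
open import Relation.Binary.PropositionalEquality using (_≡_; _≢_; refl; sym; trans; cong; subst; module ≡-Reasoning)
open import Relation.Nullary using (¬_; yes; no)
open import Relation.Nullary.Decidable using (decidable-stable)
open import Relation.Nullary.Negation using (¬¬-Monad)

open Equivalence using (to; from)
open RawMonad (¬¬-Monad {0ℓ}) using (pure; _>>=_)

Leaf : Fm → Set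
Leaf (var _)  = ⊤
Leaf (nvar _) = ⊤
Leaf tt       = ⊤
Leaf ff       = ⊤
Leaf _        = ⊥

module SizeGame {I : Set} (_#_ : I → I → Set) (Sep : Fm → I → Set)
  (leaf : ∀ {χ x y} → Leaf χ → Sep χ x → Sep χ y → ¬ (x # y))
  (conj : ∀ {χ χ' x} → Sep (χ ∧ χ') x → ¬ ¬ (Sep χ x ⊎ Sep χ' x))
  (disj : ∀ {χ χ' x} → Sep (χ ∨ χ') x → Sep χ x ⊎ Sep χ' x)
  (box  : ∀ {χ x} → ¬ Sep (□ χ) x)
  (next : I → I)
  (dia  : ∀ {χ x} → Sep (◇ χ) x → Sep χ (next x))
  (dia-# : ∀ {χ x y} → Sep (◇ χ) x → Sep (◇ χ) y → x # y → next x # next y)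
  where

  AllPairs-⊆ : ∀ {xs ys} → xs ⊆ ys → AllPairs _#_ ys → AllPairs _#_ xs
  AllPairs-⊆ [] [] = []
  AllPairs-⊆ (_ ∷ʳ s) (_ ∷ ps) = AllPairs-⊆ s ps
  AllPairs-⊆ (refl ∷ s) (r ∷ ps) = All-resp-⊆ s r ∷ AllPairs-⊆ s ps

  record Split (A B : I → Set) (P : List I) : Set where
    constructor mkSplit
    field
      left right : List I
      left⊆  : left ⊆ P
      right⊆ : right ⊆ P
      all-left  : All A left
      all-right : All B right
      length-split : length P ≡ length left + length right

  split : ∀ {A B : I → Set} {P} → All (λ x → A x ⊎ B x) P → Split A B P
  split [] = mkSplit [] [] [] [] [] [] refl
  split {P = x ∷ _} (inj₁ a ∷ rest) with split rest
  ... | mkSplit L R L⊆ R⊆ AL AR len = mkSplit (x ∷ L) R (refl ∷ L⊆) (x ∷ʳ R⊆) (a ∷ AL) AR (cong suc len)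
  split {P = x ∷ _} (inj₂ b ∷ rest) with split rest
  ... | mkSplit L R L⊆ R⊆ AL AR len = mkSplit L (x ∷ R) (x ∷ʳ L⊆) (refl ∷ R⊆) AL (b ∷ AR)
    (trans (cong suc len) (sym (+-suc (length L) (length R))))

  at-most-one : ∀ {χ} P → Leaf χ → AllPairs _#_ P → All (Sep χ) P → length P ≤ 1
  at-most-one [] _ _ _ = z≤n
  at-most-one (_ ∷ []) _ _ _ = s≤s z≤n
  at-most-one (_ ∷ _ ∷ _) isLeaf ((x#y ∷ _) ∷ _) (sx ∷ sy ∷ _) = ⊥-elim (leaf isLeaf sx sy x#y)

  next-distinct : ∀ {χ} P → AllPairs _#_ P → All (Sep (◇ χ)) P → AllPairs _#_ (map next P)
  next-distinct P d s = AllPairs.map⁺ (moved P d s)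
    where
    moved : ∀ P → AllPairs _#_ P → All (Sep (◇ _)) P → AllPairs (λ x y → next x # next y) P
    moved [] [] [] = []
    moved (x ∷ P) (x#P ∷ d) (sx ∷ s) = All.zipWith (λ (x#y , sy) → dia-# sx sy x#y) (x#P , s) ∷ moved P d s

  ¬¬-all : ∀ {Q : I → Set} {P} → All (λ x → ¬ ¬ Q x) P → ¬ ¬ All Q P
  ¬¬-all [] = pure []
  ¬¬-all (q ∷ qs) = do
    x ← q
    xs ← ¬¬-all qs
    pure (x ∷ xs)

  bound : ∀ χ P → AllPairs _#_ P → All (Sep χ) P → ¬ ¬ length P ≤ size χ
  bound-split : ∀ χ χ' P → AllPairs _#_ P → Split (Sep χ) (Sep χ') P → ¬ ¬ length P ≤ suc (size χ + size χ')

  bound (var _)  P d s = pure (at-most-one P _ d s)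
  bound (nvar _) P d s = pure (at-most-one P _ d s)
  bound tt       P d s = pure (at-most-one P _ d s)
  bound ff       P d s = pure (at-most-one P _ d s)
  bound (χ ∧ χ') P d s = do
    s' ← ¬¬-all (All.map conj s)
    bound-split χ χ' P d (split s')
  bound (χ ∨ χ') P d s = bound-split χ χ' P d (split (All.map disj s))
  bound (◇ χ) P d s = do
    h ← bound χ (map next P) (next-distinct P d s) (All.map⁺ (All.map dia s))
    pure (≤-trans (≤-reflexive (sym (length-map next P))) (m≤n⇒m≤1+n h))
  bound (□ χ) [] d s = pure z≤n
  bound (□ χ) (_ ∷ _) d (sx ∷ _) = ⊥-elim (box sx)

  bound-split χ χ' P d (mkSplit L R L⊆ R⊆ AL AR len) = do
    hL ← bound χ L (AllPairs-⊆ L⊆ d) AL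
    hR ← bound χ' R (AllPairs-⊆ R⊆ d) AR
    pure (≤-trans (≤-reflexive len) (m≤n⇒m≤1+n (+-mono-≤ hL hR)))

infix 4 _⊨_
_⊨_ : Tree → Fm → Set
t ⊨ χ = hat (treeModel t) ∣ just here ⊨ χ

_⊨∞_ : Tree → Fm → Set
t ⊨∞ χ = hat (treeModel t) ∣ nothing ⊨ χ

-- The point ∞ sees only itself and satisfies no atom, so its theory is
-- the same in every hatted model.
∞-invariant : ∀ K K' χ → hat K ∣ nothing ⊨ χ → hat K' ∣ nothing ⊨ χ
∞-invariant K K' (var _) ()
∞-invariant K K' (nvar _) _ = λ ()
∞-invariant K K' tt _ = tt
∞-invariant K K' ff ()
∞-invariant K K' (a ∧ b) (sa , sb) = ∞-invariant K K' a sa , ∞-invariant K K' b sb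
∞-invariant K K' (a ∨ b) (inj₁ s) = inj₁ (∞-invariant K K' a s)
∞-invariant K K' (a ∨ b) (inj₂ s) = inj₂ (∞-invariant K K' b s)
∞-invariant K K' (◇ a) (nothing , _ , s) = nothing , tt , ∞-invariant K K' a s
∞-invariant K K' (□ a) f nothing _ = ∞-invariant K K' a (f nothing tt)

-- A child c of t, together with ∞, is a generated submodel of the hatted
-- model of t: the embedding of positions preserves and reflects truth.
module ChildEmbedding {t c : Tree} (m : c ∈ children t) where
  private
    Kc Kt : Kripke
    Kc = hat (treeModel c)
    Kt = hat (treeModel t)

  emb : Maybe (Pos c) → Maybe (Pos t)
  emb (just p) = just (there m p)
  emb nothing  = nothing

  emb-forth : ∀ x y → R Kc x y → R Kt (emb x) (emb y)
  emb-forth (just _) (just _) r = step≺ r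
  emb-forth (just _) nothing  _ = tt
  emb-forth nothing  nothing  _ = tt

  emb-back : ∀ x z → R Kt (emb x) z → Σ (Maybe (Pos c)) λ y → (z ≡ emb y) × R Kc x y
  emb-back (just _) nothing _ = nothing , refl , tt
  emb-back (just _) (just _) (step≺ {q = q} r) = just q , refl , r
  emb-back nothing  nothing _ = nothing , refl , tt

  emb-truth : ∀ χ x → (Kc ∣ x ⊨ χ) ⇔ (Kt ∣ emb x ⊨ χ)
  emb-truth (var _) (just _) = mk⇔ (λ s → s) (λ s → s)
  emb-truth (var _) nothing = mk⇔ (λ s → s) (λ s → s)
  emb-truth (nvar _) (just _) = mk⇔ (λ s → s) (λ s → s)
  emb-truth (nvar _) nothing = mk⇔ (λ s → s) (λ s → s)
  emb-truth tt x = mk⇔ (λ s → s) (λ s → s)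
  emb-truth ff x = mk⇔ (λ s → s) (λ s → s)
  emb-truth (a ∧ b) x =
    mk⇔ (λ (sa , sb) → to (emb-truth a x) sa , to (emb-truth b x) sb)
        (λ (sa , sb) → from (emb-truth a x) sa , from (emb-truth b x) sb)
  emb-truth (a ∨ b) x =
    mk⇔ (λ { (inj₁ s) → inj₁ (to (emb-truth a x) s) ; (inj₂ s) → inj₂ (to (emb-truth b x) s) })
        (λ { (inj₁ s) → inj₁ (from (emb-truth a x) s) ; (inj₂ s) → inj₂ (from (emb-truth b x) s) })
  emb-truth (◇ a) x = mk⇔ forth back
    where
    forth : Kc ∣ x ⊨ ◇ a → Kt ∣ emb x ⊨ ◇ a
    forth (y , r , s) = emb y , emb-forth x y r , to (emb-truth a y) s
    back : Kt ∣ emb x ⊨ ◇ a → Kc ∣ x ⊨ ◇ a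
    back (z , r , s) with emb-back x z r
    ... | y , refl , r' = y , r' , from (emb-truth a y) s
  emb-truth (□ a) x = mk⇔ forth back
    where
    forth : Kc ∣ x ⊨ □ a → Kt ∣ emb x ⊨ □ a
    forth f z r with emb-back x z r
    ... | y , refl , r' = to (emb-truth a y) (f y r')
    back : Kt ∣ emb x ⊨ □ a → Kc ∣ x ⊨ □ a
    back g y r = from (emb-truth a y) (g (emb y) (emb-forth x y r))

open ChildEmbedding using (emb-truth)

◇-root⁻ : ∀ t χ → t ⊨ ◇ χ → t ⊨∞ χ ⊎ Σ Tree λ c → c ∈ children t × c ⊨ ◇⁺ χ
◇-root⁻ t χ (nothing , _ , s) = inj₁ s
◇-root⁻ t χ (just (there m here) , _ , s) =
  inj₂ (_ , m , inj₁ (from (emb-truth m χ (just here)) s))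
◇-root⁻ t χ (just (there m (there m' q)) , _ , s) =
  inj₂ (_ , m , inj₂ (just (there m' q) , root≺ , from (emb-truth m χ (just (there m' q))) s))

◇-child : ∀ {t c} χ → c ∈ children t → c ⊨ ◇⁺ χ → t ⊨ ◇ χ
◇-child χ m (inj₁ s) = just (there m here) , root≺ , to (emb-truth m χ (just here)) s
◇-child χ m (inj₂ (nothing , _ , s)) = nothing , tt , to (emb-truth m χ nothing) s
◇-child χ m (inj₂ (just p , _ , s)) = just (there m p) , root≺ , to (emb-truth m χ (just p)) s

◇-∞ : ∀ t t' χ → t' ⊨∞ χ → t ⊨ ◇ χ
◇-∞ t t' χ s = nothing , tt , ∞-invariant _ _ χ s

◇-transfer : ∀ {t u} χ → (∀ {c} → c ∈ children t → c ⊨ ◇⁺ χ → u ⊨ ◇ χ) → t ⊨ ◇ χ → u ⊨ ◇ χ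
◇-transfer {t} {u} χ f s with ◇-root⁻ t χ s
... | inj₁ s∞ = ◇-∞ u t χ s∞
... | inj₂ (_ , m , sc) = f m sc

_⊑_ : Tree → Tree → Set
t ⊑ u = ∀ {c} → c ∈ children t → c ∈ children u

◇-mono : ∀ {t u} χ → t ⊑ u → t ⊨ ◇ χ → u ⊨ ◇ χ
◇-mono χ t⊑u = ◇-transfer χ (λ m → ◇-child χ (t⊑u m))

□-anti : ∀ {t u} χ → t ⊑ u → u ⊨ □ χ → t ⊨ □ χ
□-anti χ t⊑u f nothing _ = ∞-invariant _ _ χ (f nothing tt)
□-anti χ t⊑u f (just (there m p)) _ =
  to (emb-truth m χ (just p)) (from (emb-truth (t⊑u m) χ (just p)) (f (just (there (t⊑u m) p)) root≺))

children-addAtom : ∀ a t → children (addAtom a t) ≡ children t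
children-addAtom a (node _ nothing _) = refl
children-addAtom a (node _ (just _) _) = refl

⊑-addAtom : ∀ a t → t ⊑ addAtom a t
⊑-addAtom a t = subst (_ ∈_) (sym (children-addAtom a t))

addAtom-⊑ : ∀ a t → addAtom a t ⊑ t
addAtom-⊑ a t = subst (_ ∈_) (children-addAtom a t)

TopFree : ℕ → Fm → Set
TopFree a (var k)  = k ≢ a
TopFree a (nvar k) = k ≢ a
TopFree a tt       = ⊤
TopFree a ff       = ⊤
TopFree a (χ ∧ χ') = TopFree a χ × TopFree a χ'
TopFree a (χ ∨ χ') = TopFree a χ × TopFree a χ'
TopFree a (◇ _)    = ⊤
TopFree a (□ _)    = ⊤

addAtom-truth : ∀ a χ → TopFree a χ → ∀ t → (t ⊨ χ) ⇔ (addAtom a t ⊨ χ)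
addAtom-truth a (var k) k≢a (node _ _ _) = mk⇔ there λ { (here k≡a) → ⊥-elim (k≢a k≡a) ; (there x) → x }
addAtom-truth a (nvar k) k≢a (node _ _ _) =
  mk⇔ (λ f → λ { (here k≡a) → k≢a k≡a ; (there x) → f x }) (λ f x → f (there x))
addAtom-truth a tt _ t = mk⇔ (λ s → s) (λ s → s)
addAtom-truth a ff _ t = mk⇔ (λ s → s) (λ s → s)
addAtom-truth a (χ ∧ χ') (f , f') t =
  mk⇔ (λ (s , s') → to (addAtom-truth a χ f t) s , to (addAtom-truth a χ' f' t) s')
      (λ (s , s') → from (addAtom-truth a χ f t) s , from (addAtom-truth a χ' f' t) s')
addAtom-truth a (χ ∨ χ') (f , f') t =
  mk⇔ (λ { (inj₁ s) → inj₁ (to (addAtom-truth a χ f t) s) ; (inj₂ s) → inj₂ (to (addAtom-truth a χ' f' t) s) })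
      (λ { (inj₁ s) → inj₁ (from (addAtom-truth a χ f t) s) ; (inj₂ s) → inj₂ (from (addAtom-truth a χ' f' t) s) })
addAtom-truth a (◇ χ) _ t = mk⇔ (◇-mono χ (⊑-addAtom a t)) (◇-mono χ (addAtom-⊑ a t))
addAtom-truth a (□ χ) _ t = mk⇔ (□-anti χ (addAtom-⊑ a t)) (□-anti χ (⊑-addAtom a t))

Lacks : ℕ → Tree → Set
Lacks a t = (p : Pos t) → ¬ (a ∈ label p)

lacks-node : ∀ {a as s cs} → ¬ (a ∈ as) → (∀ {c} → c ∈ children (node as s cs) → Lacks a c)
  → Lacks a (node as s cs)
lacks-node a∉as _ here = a∉as
lacks-node _ lc (there m p) = lc m p

lacks-child : ∀ {a t c} → Lacks a t → c ∈ children t → Lacks a c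
lacks-child L m p = L (there m p)

lacks-addAtom : ∀ {a} b t → a ≢ b → Lacks a t → Lacks a (addAtom b t)
lacks-addAtom b (node as s cs) a≢b L = lacks-node a∉ (λ m → lacks-child L (addAtom-⊑ b (node as s cs) m))
  where
  a∉ : ¬ (_ ∈ b ∷ as)
  a∉ (here a≡b) = a≢b a≡b
  a∉ (there a∈) = L here a∈

S-child : ∀ {c} t → c ∈ S t → c ∈ children t
S-child (node _ (just _) _) (here refl) = here refl

lacks-S : ∀ {a c} (f : ℕ → Tree) ks → (∀ k {c} → c ∈ children (f k) → Lacks a c)
  → c ∈ concatMap (λ k → S (f k)) ks → Lacks a c
lacks-S f ks L c∈ with satisfied (∈-concatMap⁻ (λ k → S (f k)) {xs = ks} c∈)
... | k , c∈S = L k (S-child (f k) c∈S)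

lacks-◇⁺ : ∀ {a c} χ → Lacks a c → ¬ (c ⊨ ◇⁺ (var a ∧ χ))
lacks-◇⁺ χ L (inj₁ (s , _)) = L here s
lacks-◇⁺ χ L (inj₂ (nothing , _ , () , _))
lacks-◇⁺ χ L (inj₂ (just p , _ , s , _)) = L p s

◇-lacking-children : ∀ {a} u χ → (∀ {c} → c ∈ children u → Lacks a c) → ¬ (u ⊨ ◇ (var a ∧ χ))
◇-lacking-children {a} u χ L s with ◇-root⁻ u (var a ∧ χ) s
... | inj₁ (() , _)
... | inj₂ (_ , m , sc) = lacks-◇⁺ χ (L m) sc

-- The children shared by 𝔄ᵍ⁺¹ and 𝔅ᵍ⁺¹ at indices above 2ᵍ:
-- ∐_{k=2}^{2ᵍ} S[𝔄ᵍ⁺¹_k], exactly as built by  step g.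
shared : ℕ → List Tree
shared g = concatMap (λ k → S (addAtom (suc g) (𝔄 g k))) (map (2 +_) (upTo (2 ^ g ∸ 1)))

glue : List ℕ → Tree × Tree → List Tree → Tree × Tree
glue as AB cs = node as (just (proj₁ AB)) (cs ++ proj₂ AB ∷ []) , node as (just (proj₂ AB)) cs

addAtom² : ℕ → Tree × Tree → Tree × Tree
addAtom² a AB = addAtom a (proj₁ AB) , addAtom a (proj₂ AB)

≤ᵇ-false : ∀ {m n} → ¬ m ≤ n → (m ≤ᵇ n) ≡ false
≤ᵇ-false {m} {n} m≰n with m ≤ᵇ n in eq
... | false = refl
... | true = ⊥-elim (m≰n (≤ᵇ⇒≤ m n (subst T (sym eq) tt)))

step-low : ∀ n prev i → i ≤ 2 ^ n → step n prev i ≡ addAtom² (suc n) (prev i)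
step-low n prev i i≤ rewrite to T-≡ (≤⇒≤ᵇ i≤) = refl

step-high : ∀ n prev i → 2 ^ n < i → step n prev i ≡
  glue [] (addAtom² (suc n) (prev (i ∸ 2 ^ n)))
       (concatMap (λ k → S (addAtom (suc n) (proj₁ (prev k)))) (map (2 +_) (upTo (2 ^ n ∸ 1))))
step-high n prev i 2ⁿ<i rewrite ≤ᵇ-false (<⇒≱ 2ⁿ<i) = refl

AB-low : ∀ m i → i ≤ 2 ^ suc m → AB (suc (suc m)) i ≡ addAtom² (suc (suc m)) (AB (suc m) i)
AB-low m = step-low (suc m) (AB (suc m))

2ᵍ<2ᵍ+j : ∀ g {j} → 1 ≤ j → 2 ^ g < 2 ^ g + j
2ᵍ<2ᵍ+j g 1≤j = subst (_< 2 ^ g + _) (+-identityʳ (2 ^ g)) (+-monoʳ-< (2 ^ g) 1≤j)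

2ᵍ+j≤2ᵉ : ∀ {g e j} → g < e → j ≤ 2 ^ g → 2 ^ g + j ≤ 2 ^ e
2ᵍ+j≤2ᵉ {g} g<e j≤ = ≤-trans (+-monoʳ-≤ (2 ^ g) j≤)
  (≤-trans (≤-reflexive (cong (2 ^ g +_) (sym (+-identityʳ (2 ^ g))))) (^-monoʳ-≤ 2 g<e))

AB-top : ∀ g j → 1 ≤ j → j ≤ 2 ^ g → AB (suc g) (2 ^ g + j) ≡ glue [] (AB (suc g) j) (shared g)
AB-top zero (suc zero) _ _ = refl
AB-top zero (suc (suc _)) _ (s≤s ())
AB-top (suc m) j 1≤j j≤ = begin
  step (suc m) (AB (suc m)) (2 ^ suc m + j)
    ≡⟨ step-high (suc m) (AB (suc m)) _ (2ᵍ<2ᵍ+j (suc m) 1≤j) ⟩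
  glue [] (addAtom² (suc (suc m)) (AB (suc m) (2 ^ suc m + j ∸ 2 ^ suc m))) (shared (suc m))
    ≡⟨ cong (λ k → glue [] (addAtom² (suc (suc m)) (AB (suc m) k)) (shared (suc m))) (m+n∸m≡n (2 ^ suc m) j) ⟩
  glue [] (addAtom² (suc (suc m)) (AB (suc m) j)) (shared (suc m))
    ≡⟨ cong (λ p → glue [] p (shared (suc m))) (sym (AB-low m j j≤)) ⟩
  glue [] (AB (suc (suc m)) j) (shared (suc m)) ∎
  where open ≡-Reasoning

AB-shape : ∀ e g j → g < e → 1 ≤ j → j ≤ 2 ^ g →
  Σ (List ℕ) λ as → AB e (2 ^ g + j) ≡ glue as (AB (suc g) j) (shared g)
AB-shape (suc e) g j (s≤s g≤e) 1≤j j≤ with m≤n⇒m<n∨m≡n g≤e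
... | inj₂ refl = [] , AB-top g j 1≤j j≤
AB-shape (suc (suc e)) g j (s≤s g≤e) 1≤j j≤ | inj₁ g<e with AB-shape (suc e) g j g<e 1≤j j≤
... | as , eq = suc (suc e) ∷ as ,
  trans (AB-low e (2 ^ g + j) (2ᵍ+j≤2ᵉ g<e j≤)) (cong (addAtom² (suc (suc e))) eq)

AB-one : ∀ e → Σ (List ℕ) λ as → Σ (List ℕ) λ bs → AB e 1 ≡ (node as nothing [] , node bs nothing [])
AB-one zero = _ , _ , refl
AB-one (suc zero) = _ , _ , refl
AB-one (suc (suc m)) with AB-one (suc m)
... | as , bs , eq = _ , _ , trans (AB-low m 1 (m^n>0 2 (suc m))) (cong (addAtom² (suc (suc m))) eq)

decompose : ℕ → ℕ → ℕ × ℕ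
decompose zero i = zero , i
decompose (suc e) i with i ≤? 2 ^ e
... | yes _ = decompose e i
... | no _  = e , i ∸ 2 ^ e

IsDecomposition : ℕ → ℕ → ℕ × ℕ → Set
IsDecomposition e i (g , j) = g < e × 1 ≤ j × j ≤ 2 ^ g × i ≡ 2 ^ g + j

upper-index : ∀ g {i} → 2 ^ g < i → i ≤ 2 ^ suc g → 1 ≤ i ∸ 2 ^ g × i ∸ 2 ^ g ≤ 2 ^ g
upper-index g {i} 2ᵍ<i i≤ = m<n⇒0<n∸m 2ᵍ<i ,
  ≤-trans (∸-monoˡ-≤ (2 ^ g) (≤-trans i≤ (≤-reflexive (cong (2 ^ g +_) (+-identityʳ (2 ^ g))))))
          (≤-reflexive (m+n∸m≡n (2 ^ g) (2 ^ g)))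

decompose-correct : ∀ e i → 2 ≤ i → i ≤ 2 ^ e → IsDecomposition e i (decompose e i)
decompose-correct zero i (s≤s (s≤s _)) (s≤s ())
decompose-correct (suc e) i 2≤i i≤ with i ≤? 2 ^ e
... | yes i≤' = let (g<e , rest) = decompose-correct e i 2≤i i≤' in m<n⇒m<1+n g<e , rest
... | no i≰ = let (1≤j , j≤) = upper-index e (≰⇒> i≰) i≤ in
  n<1+n e , 1≤j , j≤ , sym (m+[n∸m]≡n (<⇒≤ (≰⇒> i≰)))

-- 𝔄ᵍ⁺¹_j is the successor of 𝔄^{g'}_{2ᵍ+j} and hence one of the shared
-- children at every higher level g' > g.
𝔄∈shared : ∀ g g' j → g < g' → 1 ≤ j → j ≤ 2 ^ g → 𝔄 (suc g) j ∈ shared g'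
𝔄∈shared g g' j g<g' 1≤j j≤ = ∈-concatMap⁺ (λ k → S (addAtom (suc g') (𝔄 g' k))) (lose k∈ 𝔄∈S)
  where
  k = 2 ^ g + j
  𝔄∈S : 𝔄 (suc g) j ∈ S (addAtom (suc g') (𝔄 g' k))
  𝔄∈S with AB-shape g' g j g<g' 1≤j j≤
  ... | _ , eq rewrite eq = here refl
  2≤k : 2 ≤ k
  2≤k = +-mono-≤ (m^n>0 2 g) 1≤j
  k∈ : k ∈ map (2 +_) (upTo (2 ^ g' ∸ 1))
  k∈ = subst (_∈ map (2 +_) (upTo (2 ^ g' ∸ 1))) (m+[n∸m]≡n 2≤k)
         (∈-map⁺ (2 +_) (∈-upTo⁺ (≤-trans (≤-reflexive (sym (+-∸-assoc 1 2≤k)))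
                                          (∸-monoˡ-≤ 1 (2ᵍ+j≤2ᵉ g<g' j≤)))))

BothLack : ℕ → Tree × Tree → Set
BothLack a AB = Lacks a (proj₁ AB) × Lacks a (proj₂ AB)

lacks-addAtom² : ∀ {a} b AB → a ≢ b → BothLack a AB → BothLack a (addAtom² b AB)
lacks-addAtom² b (A , B) a≢b (LA , LB) = lacks-addAtom b A a≢b LA , lacks-addAtom b B a≢b LB

lacks-glue : ∀ {a} as AB cs → ¬ (a ∈ as) → BothLack a AB → (∀ {c} → c ∈ cs → Lacks a c)
  → BothLack a (glue as AB cs)
lacks-glue as (A , B) cs a∉ (LA , LB) Lcs =
  lacks-node a∉ (λ { (here refl) → LA ; (there c∈) → lacks-shared-or-B c∈ }) ,
  lacks-node a∉ (λ { (here refl) → LB ; (there c∈) → Lcs c∈ })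
  where
  lacks-shared-or-B : ∀ {c} → c ∈ cs ++ B ∷ [] → Lacks _ c
  lacks-shared-or-B c∈ with ∈-++⁻ cs c∈
  ... | inj₁ c∈cs = Lcs c∈cs
  ... | inj₂ (here refl) = LB

lacks-step : ∀ n prev a → a ≢ suc n → (∀ k → BothLack a (prev k)) → ∀ i → BothLack a (step n prev i)
lacks-step n prev a a≢ L i with i ≤? 2 ^ n
... | yes i≤ = subst (BothLack a) (sym (step-low n prev i i≤)) (lacks-addAtom² (suc n) (prev i) a≢ (L i))
... | no i≰ = subst (BothLack a) (sym (step-high n prev i (≰⇒> i≰)))
  (lacks-glue [] _ _ (λ ()) (lacks-addAtom² (suc n) (prev (i ∸ 2 ^ n)) a≢ (L (i ∸ 2 ^ n)))
    (lacks-S _ (map (2 +_) (upTo (2 ^ n ∸ 1)))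
      (λ k c∈ → lacks-child (proj₁ (L k)) (addAtom-⊑ (suc n) (proj₁ (prev k)) c∈))))

lacks-leaf : ∀ {a as} → ¬ (a ∈ as) → Lacks a (node as nothing [])
lacks-leaf a∉ = lacks-node a∉ (λ ())

lacks-AB : ∀ m a k → 1 ≤ m → m < a → BothLack a (AB m k)
lacks-AB (suc zero) a k _ 1<a = at-level-1 k
  where
  leaves : BothLack a (node (1 ∷ []) nothing [] , node [] nothing [])
  leaves = lacks-leaf (λ { (here refl) → <-irrefl refl 1<a }) , lacks-leaf (λ ())
  at-level-1 : ∀ k → BothLack a (AB 1 k)
  at-level-1 zero          = leaves
  at-level-1 (suc zero)    = leaves
  at-level-1 (suc (suc _)) = lacks-glue [] (_ , _) [] (λ ()) leaves (λ ())
lacks-AB (suc (suc m)) a k _ m<a =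
  lacks-step (suc m) (AB (suc m)) a (λ { refl → <-irrefl refl m<a })
    (λ k' → lacks-AB (suc m) a k' (s≤s z≤n) (<-trans (n<1+n (suc m)) m<a)) k

lacks-shared : ∀ g a {c} → 1 ≤ g → g < a → c ∈ shared g → Lacks a c
lacks-shared g a 1≤g g<a = lacks-S _ (map (2 +_) (upTo (2 ^ g ∸ 1)))
  (λ k c∈ → lacks-child (proj₁ (lacks-AB g a k 1≤g g<a)) (addAtom-⊑ (suc g) (𝔄 g k) c∈))

Separates : Fm → Tree × Tree → Set
Separates χ AB = (proj₁ AB ⊨ χ) × ¬ (proj₂ AB ⊨ χ)

-- A single point sees only ∞, so its ◇-formulas hold everywhere.
◇-leaf : ∀ {as u} χ → node as nothing [] ⊨ ◇ χ → u ⊨ ◇ χ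
◇-leaf χ = ◇-transfer χ (λ ())

addAtom-var : ∀ a t → addAtom a t ⊨ var a
addAtom-var a (node _ _ _) = here refl

φ-topFree : ∀ m a → suc m < a → TopFree a (φ (suc m))
φ-topFree zero a 1<a = <⇒≢ 1<a , tt
φ-topFree (suc m) a m<a = (<⇒≢ m<a , φ-topFree m a (<-trans (n<1+n (suc m)) m<a)) , tt

-- Level 1: 𝔄¹₁ satisfies p_1, 𝔄¹₂ sees 𝔄¹₁; no p_1 is visible in 𝔅¹₁, 𝔅¹₂.
φ₁-separates : ∀ i → 1 ≤ i → i ≤ 2 → Separates (φ 1) (AB 1 i)
φ₁-separates (suc zero) _ _ = inj₁ (here refl) , point-fails
  where
  point-fails : ¬ (node [] nothing [] ⊨ φ 1)
  point-fails (inj₂ s) with ◇-root⁻ _ (var 1) s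
  ... | inj₁ ()
φ₁-separates (suc (suc zero)) _ _ = inj₂ (◇-child (var 1) (here refl) (inj₁ (here refl))) , root-fails
  where
  root-fails : ¬ (node [] (just (node [] nothing [])) [] ⊨ φ 1)
  root-fails (inj₂ s) with ◇-root⁻ _ (var 1) s
  ... | inj₁ ()
  ... | inj₂ (_ , here refl , inj₂ s') with ◇-root⁻ _ (var 1) s'
  ...   | inj₁ ()
φ₁-separates (suc (suc (suc _))) _ (s≤s (s≤s ()))

module φ-Step (m : ℕ) (IH : ∀ i → 1 ≤ i → i ≤ 2 ^ suc m → Separates (φ (suc m)) (AB (suc m) i)) where
  e = suc (suc m)
  θ = var e ∧ φ (suc m)

  private
    topFree : TopFree e (φ (suc m))
    topFree = φ-topFree m e (n<1+n (suc m))

  lower-𝔄 : ∀ i → 1 ≤ i → i ≤ 2 ^ suc m → 𝔄 e i ⊨ θ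
  lower-𝔄 i 1≤i i≤ rewrite AB-low m i i≤ =
    addAtom-var e (𝔄 (suc m) i) , to (addAtom-truth e (φ (suc m)) topFree (𝔄 (suc m) i)) (proj₁ (IH i 1≤i i≤))

  -- Below 𝔅ᵉᵢ (i ≤ 2ᵐ⁺¹) the atom p_e is false, so ◇ θ fails there.
  lower-𝔅 : ∀ i → 1 ≤ i → i ≤ 2 ^ suc m → ¬ (𝔅 e i ⊨ ◇⁺ θ)
  lower-𝔅 i 1≤i i≤ rewrite AB-low m i i≤ = λ
    { (inj₁ (_ , s)) → proj₂ (IH i 1≤i i≤) (from (addAtom-truth e (φ (suc m)) topFree (𝔅 (suc m) i)) s)
    ; (inj₂ s) → ◇-lacking-children _ (φ (suc m))
        (λ c∈ → lacks-child (proj₂ (lacks-AB (suc m) e i (s≤s z≤n) (n<1+n (suc m)))) (addAtom-⊑ e (𝔅 (suc m) i) c∈)) s }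

  upper : ∀ j → 1 ≤ j → j ≤ 2 ^ suc m → Separates (φ e) (AB e (2 ^ suc m + j))
  -- 𝔄ᵉ sees its successor 𝔄ᵉ_j ⊨ θ; 𝔅ᵉ has no p_e at the root, its
  -- successor 𝔅ᵉ_j fails ◇⁺ θ, and its shared children lack p_e.
  upper j 1≤j j≤ rewrite AB-top (suc m) j 1≤j j≤ =
    inj₂ (◇-child θ (here refl) (inj₁ (lower-𝔄 j 1≤j j≤))) , 𝔅-fails
    where
    𝔅-fails : ¬ (node [] (just (𝔅 e j)) (shared (suc m)) ⊨ φ e)
    𝔅-fails (inj₂ s) with ◇-root⁻ _ θ s
    ... | inj₁ (() , _)
    ... | inj₂ (_ , here refl , sc) = lower-𝔅 j 1≤j j≤ sc
    ... | inj₂ (_ , there c∈ , sc) = lacks-◇⁺ (φ (suc m)) (lacks-shared (suc m) e (s≤s z≤n) (n<1+n (suc m)) c∈) sc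

  separates : ∀ i → 1 ≤ i → i ≤ 2 ^ e → Separates (φ e) (AB e i)
  separates i 1≤i i≤ with i ≤? 2 ^ suc m
  ... | yes i≤' = inj₁ (lower-𝔄 i 1≤i i≤') , lower-𝔅 i 1≤i i≤'
  ... | no i≰ = subst (λ k → Separates (φ e) (AB e k)) (m+[n∸m]≡n (<⇒≤ (≰⇒> i≰))) (upper _ 1≤j j≤)
    where
    1≤j = proj₁ (upper-index (suc m) (≰⇒> i≰) i≤)
    j≤ = proj₂ (upper-index (suc m) (≰⇒> i≰) i≤)

φ-separates : ∀ n → 1 ≤ n → ∀ i → 1 ≤ i → i ≤ 2 ^ n → Separates (φ n) (AB n i)
φ-separates (suc zero) _ = φ₁-separates
φ-separates (suc (suc m)) _ = φ-Step.separates m (φ-separates (suc m) (s≤s z≤n))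

data Shape (e i : ℕ) : Set where
  point : ∀ {as bs} → i ≡ 1 → AB e i ≡ (node as nothing [] , node bs nothing []) → Shape e i
  glued : ∀ {g j as} → decompose e i ≡ (g , j) → IsDecomposition e i (g , j)
        → AB e i ≡ glue as (AB (suc g) j) (shared g) → Shape e i

shape : ∀ e i → 1 ≤ i → i ≤ 2 ^ e → Shape e i
shape e (suc zero) _ _ = let (_ , _ , AB≡) = AB-one e in point refl AB≡
shape e (suc (suc k)) _ i≤ with decompose e (suc (suc k)) in eq
... | (g , j) = glued eq dc (trans (cong (AB e) i≡) (proj₂ (AB-shape e g j g<e 1≤j j≤)))
  where
  dc : IsDecomposition e (suc (suc k)) (g , j)
  dc = subst (IsDecomposition e _) eq (decompose-correct e _ (s≤s (s≤s z≤n)) i≤)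
  g<e = proj₁ dc
  1≤j = proj₁ (proj₂ dc)
  j≤ = proj₁ (proj₂ (proj₂ dc))
  i≡ = proj₂ (proj₂ (proj₂ dc))

glue-children : ∀ as A B cs {c} → c ∈ children (proj₁ (glue as (A , B) cs))
  → c ≡ A ⊎ c ∈ children (proj₂ (glue as (A , B) cs))
glue-children as A B cs (here c≡A) = inj₁ c≡A
glue-children as A B cs (there c∈) with ∈-++⁻ cs c∈
... | inj₁ c∈cs = inj₂ (there c∈cs)
... | inj₂ (here refl) = inj₂ (here refl)

glue-⊑ : ∀ as AB cs → proj₂ (glue as AB cs) ⊑ proj₁ (glue as AB cs)
glue-⊑ as AB cs (here refl) = there (∈-++⁺ʳ cs (here refl))
glue-⊑ as AB cs (there c∈) = there (∈-++⁺ˡ c∈)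

-- Literals, ⊤ and ⊥ cannot separate the two roots of a glued pair: they
-- carry the same atoms.
literal-glue : ∀ χ as AB cs → Leaf χ → ¬ Separates χ (glue as AB cs)
literal-glue (var _) as AB cs _ (s , ns) = ns s
literal-glue (nvar _) as AB cs _ (s , ns) = ns s
literal-glue tt as AB cs _ (_ , ns) = ns tt
literal-glue ff as AB cs _ (() , _)

◇-glue : ∀ χ as A B cs → (A ⊨ ◇ χ → proj₂ (glue as (A , B) cs) ⊨ ◇ χ)
  → Separates (◇ χ) (glue as (A , B) cs) → Separates χ (A , B)
◇-glue χ as A B cs visible (s , ns) = 𝔄-sat , λ b → ns (◇-child χ (here refl) (inj₁ b))
  where
  𝔄-sat : A ⊨ χ
  𝔄-sat with ◇-root⁻ _ χ s
  ... | inj₁ s∞ = ⊥-elim (ns (◇-∞ _ _ χ s∞))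
  ... | inj₂ (c , c∈ , sc) with glue-children as A B cs c∈
  ...   | inj₂ c∈' = ⊥-elim (ns (◇-child χ c∈' sc))
  ...   | inj₁ refl with sc
  ...     | inj₁ a = a
  ...     | inj₂ a = ⊥-elim (ns (visible a))

-- ◇ χ at 𝔄ᵍ⁺¹_j is visible from the second root of a glued pair over it:
-- the successor of 𝔄ᵍ⁺¹_j is a shared child at level g, and its other
-- children are children of 𝔅ᵍ⁺¹_j.
𝔄-◇-visible : ∀ χ g j as → 1 ≤ j → j ≤ 2 ^ g
  → 𝔄 (suc g) j ⊨ ◇ χ → proj₂ (glue as (AB (suc g) j) (shared g)) ⊨ ◇ χ
𝔄-◇-visible χ g j as 1≤j j≤ s with shape (suc g) j 1≤j (≤-trans j≤ (^-monoʳ-≤ 2 (n≤1+n g)))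
... | point _ AB≡ = ◇-leaf χ (subst (_⊨ ◇ χ) (cong proj₁ AB≡) s)
... | glued {g'} {j'} {as'} _ (g'<1+g , 1≤j' , j'≤ , j≡) AB≡ =
  ◇-transfer χ through (subst (_⊨ ◇ χ) (cong proj₁ AB≡) s)
  where
  g'<g : g' < g
  g'<g with m≤n⇒m<n∨m≡n (≤-pred g'<1+g)
  ... | inj₁ g'<g = g'<g
  ... | inj₂ refl = ⊥-elim (<⇒≱ (subst (2 ^ g <_) (sym j≡) (2ᵍ<2ᵍ+j g 1≤j')) j≤)
  through : ∀ {c} → c ∈ children (proj₁ (glue as' (AB (suc g') j') (shared g'))) → c ⊨ ◇⁺ χ
    → proj₂ (glue as (AB (suc g) j) (shared g)) ⊨ ◇ χ
  through c∈ sc with glue-children as' _ _ (shared g') c∈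
  ... | inj₁ refl = ◇-child χ (there (𝔄∈shared g' g j' g'<g 1≤j' j'≤)) sc
  ... | inj₂ c∈' = ◇-child χ (here refl) (inj₂ (subst (_⊨ ◇ χ) (sym (cong proj₂ AB≡)) (◇-child χ c∈' sc)))

Item : Set
Item = ℕ × ℕ

level index : Item → ℕ
level = proj₁
index = proj₂

_#_ : Item → Item → Set
x # y = index x ≢ index y

record Sep (χ : Fm) (x : Item) : Set where
  constructor mkSep
  field
    legal : 1 ≤ index x × index x ≤ 2 ^ level x
    separation : Separates χ (AB (level x) (index x))

-- The ◇-move: from the pair (𝔄ᵉ_{2ᵍ+j}, 𝔅ᵉ_{2ᵍ+j}) to its successors.
next : Item → Item
next x = suc (proj₁ (decompose (level x) (index x))) , proj₂ (decompose (level x) (index x))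

-- Only the point pairs (index 1) can be separated by a single node, so
-- single nodes never separate two distinct items.
index-one : ∀ χ e i → Leaf χ → Sep χ (e , i) → i ≡ 1
index-one χ e i isLeaf (mkSep (1≤i , i≤) sep) with shape e i 1≤i i≤
... | point i≡1 _ = i≡1
... | glued _ _ AB≡ = ⊥-elim (literal-glue χ _ _ _ isLeaf (subst (Separates χ) AB≡ sep))

sep-leaf : ∀ {χ x y} → Leaf χ → Sep χ x → Sep χ y → ¬ (x # y)
sep-leaf {χ} {e , i} {e' , i'} isLeaf sx sy i≢i' =
  i≢i' (trans (index-one χ e i isLeaf sx) (sym (index-one χ e' i' isLeaf sy)))

sep-conj : ∀ {χ χ' x} → Sep (χ ∧ χ') x → ¬ ¬ (Sep χ x ⊎ Sep χ' x)
sep-conj (mkSep v ((a , a') , nb)) k = k (inj₂ (mkSep v (a' , λ b' → k (inj₁ (mkSep v (a , λ b → nb (b , b')))))))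

sep-disj : ∀ {χ χ' x} → Sep (χ ∨ χ') x → Sep χ x ⊎ Sep χ' x
sep-disj (mkSep v (inj₁ a , nb)) = inj₁ (mkSep v (a , λ b → nb (inj₁ b)))
sep-disj (mkSep v (inj₂ a , nb)) = inj₂ (mkSep v (a , λ b → nb (inj₂ b)))

-- □ never separates: the children of 𝔅ᵉᵢ are children of 𝔄ᵉᵢ.
sep-box : ∀ {χ x} → ¬ Sep (□ χ) x
sep-box {χ} {e , i} (mkSep (1≤i , i≤) (a , nb)) = nb (□-anti χ 𝔅⊑𝔄 a)
  where
  𝔅⊑𝔄 : 𝔅 e i ⊑ 𝔄 e i
  𝔅⊑𝔄 with shape e i 1≤i i≤
  ... | point _ AB≡ rewrite AB≡ = λ ()
  ... | glued {as = as} _ _ AB≡ rewrite AB≡ = glue-⊑ as _ _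

point-◇ : ∀ χ e i {as bs} → AB e i ≡ (node as nothing [] , node bs nothing []) → ¬ Separates (◇ χ) (AB e i)
point-◇ χ e i AB≡ sep = let (s , ns) = subst (Separates (◇ χ)) AB≡ sep in ns (◇-leaf χ s)

sep-dia : ∀ {χ x} → Sep (◇ χ) x → Sep χ (next x)
sep-dia {χ} {e , i} (mkSep (1≤i , i≤) sep) with shape e i 1≤i i≤
... | point _ AB≡ = ⊥-elim (point-◇ χ e i AB≡ sep)
... | glued {g} {j} dec≡ (_ , 1≤j , j≤ , _) AB≡ rewrite dec≡ =
  mkSep (1≤j , ≤-trans j≤ (^-monoʳ-≤ 2 (n≤1+n g)))
  (◇-glue χ _ _ _ _ (𝔄-◇-visible χ g j _ 1≤j j≤) (subst (Separates (◇ χ)) AB≡ sep))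

shared-◇ : ∀ χ e i {g j as c} → AB e i ≡ glue as (AB (suc g) j) (shared g) → c ∈ shared g → c ⊨ χ → 𝔅 e i ⊨ ◇ χ
shared-◇ χ e i AB≡ c∈ s = subst (_⊨ ◇ χ) (sym (cong proj₂ AB≡)) (◇-child χ (there c∈) (inj₁ s))

-- Distinct pairs separated by ◇ χ move to distinct pairs: equal successor
-- indices j at different levels g < g' are impossible, as 𝔄ᵍ⁺¹_j is a
-- shared child at level g'.
sep-dia-# : ∀ {χ x y} → Sep (◇ χ) x → Sep (◇ χ) y → x # y → next x # next y
sep-dia-# {χ} {e , i} {e' , i'} (mkSep (1≤i , i≤) sepx) (mkSep (1≤i' , i'≤) sepy) i≢i'
  with shape e i 1≤i i≤ | shape e' i' 1≤i' i'≤
... | point _ AB≡ | _ = ⊥-elim (point-◇ χ e i AB≡ sepx)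
... | glued _ _ _ | point _ AB≡ = ⊥-elim (point-◇ χ e' i' AB≡ sepy)
... | glued {g} {j} dec≡ (_ , 1≤j , j≤ , i≡) AB≡ | glued {g'} {j'} dec≡' (_ , 1≤j' , j'≤ , i'≡) AB≡'
  rewrite dec≡ | dec≡' = λ j≡j' → by-level j≡j' (<-cmp g g')
  where
  𝔄-sat : 𝔄 (suc g) j ⊨ χ
  𝔄-sat = proj₁ (◇-glue χ _ _ _ _ (𝔄-◇-visible χ g j _ 1≤j j≤) (subst (Separates (◇ χ)) AB≡ sepx))
  𝔄'-sat : 𝔄 (suc g') j' ⊨ χ
  𝔄'-sat = proj₁ (◇-glue χ _ _ _ _ (𝔄-◇-visible χ g' j' _ 1≤j' j'≤) (subst (Separates (◇ χ)) AB≡' sepy))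
  by-level : j ≡ j' → Tri (g < g') (g ≡ g') (g' < g) → ⊥
  by-level refl (tri< g<g' _ _) = proj₂ sepy (shared-◇ χ e' i' {g'} {j'} AB≡' (𝔄∈shared g g' j g<g' 1≤j j≤) 𝔄-sat)
  by-level refl (tri≈ _ refl _) = i≢i' (trans i≡ (sym i'≡))
  by-level refl (tri> _ _ g'<g) = proj₂ sepx (shared-◇ χ e i {g} {j} AB≡ (𝔄∈shared g' g j g'<g 1≤j' j'≤) 𝔄'-sat)

open SizeGame _#_ Sep sep-leaf sep-conj sep-disj sep-box next sep-dia sep-dia-#

proposition7p24 : (n : ℕ) → 1 ≤ n → (ψ : Fm)
    → ((i : ℕ) → 1 ≤ i → i ≤ 2 ^ n
        → ((hat (treeModel (𝔄 n i)) ∣ just here ⊨ φ n) ⇔ (hat (treeModel (𝔄 n i)) ∣ just here ⊨ ψ))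
        × ((hat (treeModel (𝔅 n i)) ∣ just here ⊨ φ n) ⇔ (hat (treeModel (𝔅 n i)) ∣ just here ⊨ ψ)))
    → 2 ^ n ≤ size ψ
-- The 2ⁿ pairs of level n are distinct, and ψ separates each of them since
-- φ_n does and ψ agrees with φ_n; the size game bounds |ψ| from below.
proposition7p24 n 1≤n ψ agree =
  decidable-stable (2 ^ n ≤? size ψ)
    (subst (λ l → ¬ ¬ l ≤ size ψ) (length-applyUpTo pair (2 ^ n)) (bound ψ level-n distinct separated))
  where
  pair : ℕ → Item
  pair k = n , suc k
  level-n : List Item
  level-n = applyUpTo pair (2 ^ n)
  distinct : AllPairs _#_ level-n
  distinct = AllPairs.applyUpTo⁺₁ pair (2 ^ n) (λ k<k' _ → <⇒≢ (s≤s k<k'))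
  separated : All (Sep ψ) level-n
  separated = All.applyUpTo⁺₁ pair (2 ^ n) λ {k} k< →
    let (a , nb) = φ-separates n 1≤n (suc k) (s≤s z≤n) k<
        (agree-𝔄 , agree-𝔅) = agree (suc k) (s≤s z≤n) k<
    in mkSep (s≤s z≤n , k<) (to agree-𝔄 a , λ b → nb (from agree-𝔅 b))
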